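{- Let $k$ be a positive integer. If there exist an even integer $u\ge2$ and a positive integer $r\ne u$ such that $L_{u+2}(k)=0\,0\,1^u$ and $U_{r+1}(k)=1^r\,0$, then $f(k)<k$.
   Context: $s_2(n)$ is the binary sum of digits of $n\ge0$, $t_n=s_2(n)\bmod 2$, and $f(k)=\min\{n\ge0: t_{kn}=1\}$ for $k\ge1$. If $k=\sum_{i=0}^{\ell-1}\varepsilon_i 2^i$ with $\varepsilon_i\in\{0,1\}$, $\varepsilon_{\ell-1}=1$, then $\ell=\ell(k)$ is the binary length; for $1\le j\le \ell(k)$, $L_j(k)=\varepsilon_{j-1}\cdots\varepsilon_0$ is the word of the $j$ least significant binary digits and $U_j(k)=\varepsilon_{\ell-1}\cdots\varepsilon_{\ell-j}$ is the word of the $j$ most significant binary digits (use of $L_j(k)$ or $U_j(k)$ presupposes $\ell(k)\ge j$). For $a\in\{0,1\}$, $a^n$ denotes the word consisting of $n$ copies of $a$; juxtaposition denotes concatenation. -}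

module Defs where

open import Data.Nat using (ℕ; zero; suc; _+_; _*_; _<_; _≤_; _/_; _%_)
open import Data.Bool using (Bool; true; false)
open import Data.List using (List; []; _∷_; length; reverse; take; replicate; _++_)
open import Data.Product using (_×_)
open import Relation.Binary.PropositionalEquality using (_≡_)

-- binary digits, least significant first, of n (fuel-bounded; fuel n suffices)
bitsAux : ℕ → ℕ → List Bool
bitsAux zero    _ = []
bitsAux (suc f) zero = []
bitsAux (suc f) n@(suc _) = (if-odd (n % 2)) ∷ bitsAux f (n / 2)
  where
  if-odd : ℕ → Bool
  if-odd zero = false
  if-odd (suc _) = true

-- ε₀ ε₁ … ε_{ℓ-1}  (LSB first); empty for n = 0
bitsLSB : ℕ → List Bool
bitsLSB n = bitsAux n n

len : ℕ → ℕ
len n = length (bitsLSB n)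

s₂ : ℕ → ℕ
s₂ n = count (bitsLSB n)
  where
  count : List Bool → ℕ
  count [] = 0
  count (true ∷ bs) = suc (count bs)
  count (false ∷ bs) = count bs

t : ℕ → ℕ
t n = s₂ n % 2

-- L_j(k) = ε_{j-1} ⋯ ε₀ (written most significant first)
L : ℕ → ℕ → List Bool
L j k = reverse (take j (bitsLSB k))

-- U_j(k) = ε_{ℓ-1} ⋯ ε_{ℓ-j}
U : ℕ → ℕ → List Bool
U j k = take j (reverse (bitsLSB k))

-- m = f(k) = min { n ≥ 0 : t_{kn} = 1 }
IsF : ℕ → ℕ → Set
IsF k m = (t (k * m) ≡ 1) × (∀ n → n < m → t (k * n) ≡ 0)

{-# OPTIONS --safe #-}
-- Write β for the binary word of k, least significant digit first; the hypotheses say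
-- β = 1ᵘ00R = D01ʳ.  Split β = BT and put b = |B|, so k = B + 2ᵇT and
-- k(2ᵇ + 1) = B + 2ᵇ(T + k).  If the low block 1ᵘ00 plus T is a word M of the same
-- length u + 2, the carry stays inside that block, T + k has the digits M R, and
--   s₂(k(2ᵇ + 1)) + s₂(T) = s₂(1ᵘ00) + s₂(M) + 2 s₂(R).
-- Taking T = 1ᵘ⁺¹ when r > u and T = 01ʳ when r < u, such an M exists and, u being
-- even, s₂(k(2ᵇ + 1)) is odd; moreover 2ᵇ + 1 < k since B is nonempty and T ≥ 2.
module Submission where

open import Defs
open import Data.Nat using (ℕ; zero; suc; _+_; _*_; _^_; _<_; _≤_; _%_; _/_; _∸_; z≤n; s≤s)
open import Data.Nat.Properties
open import Data.Nat.DivMod using (m%n<n; m/n<m; m≡m%n+[m/n]*n; [m+kn]%n≡m%n; +-distrib-/-∣ʳ; m*n/n≡m)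
open import Data.Nat.Divisibility using (divides)
open import Data.Nat.Induction using (<-rec)
open import Data.Nat.Tactic.RingSolver using (solve-∀)
open import Data.Bool using (Bool; true; false)
open import Data.List using (List; []; _∷_; _++_; length; reverse; replicate; take; drop)
open import Data.List.Properties
  using (++-assoc; length-++; length-replicate; length-++-≤ʳ; take++drop≡id;
         reverse-involutive; reverse-++; unfold-reverse)
open import Data.Product using (Σ; _×_; _,_)
open import Data.Sum using (_⊎_; inj₁; inj₂; [_,_]′)
open import Data.Empty using (⊥-elim)
open import Relation.Binary.PropositionalEquality
open import Relation.Binary.Definitions using (Tri; tri<; tri≈; tri>)
open import Relation.Nullary using (yes; no)

toBit : ℕ → Bool
toBit zero    = false
toBit (suc _) = true

bitValue : Bool → ℕ
bitValue false = 0
bitValue true  = 1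

fromBits : List Bool → ℕ
fromBits []       = 0
fromBits (b ∷ bs) = bitValue b + fromBits bs * 2

ones : List Bool → ℕ
ones []       = 0
ones (b ∷ bs) = bitValue b + ones bs

bitValue-toBit : ∀ n → n < 2 → bitValue (toBit n) ≡ n
bitValue-toBit 0 _ = refl
bitValue-toBit 1 _ = refl
bitValue-toBit (suc (suc _)) (s≤s (s≤s ()))

bitValue%2 : ∀ b → bitValue b % 2 ≡ bitValue b
bitValue%2 false = refl
bitValue%2 true  = refl

bitValue/2 : ∀ b → bitValue b / 2 ≡ 0
bitValue/2 false = refl
bitValue/2 true  = refl

half<self : ∀ m → suc m / 2 < suc m
half<self m = m/n<m (suc m) 2 (s≤s (s≤s z≤n))

-- The digit function of Defs is local, so it meets toBit only after splitting on the parity.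
bitsAux-suc : ∀ f m → bitsAux (suc f) (suc m) ≡ toBit (suc m % 2) ∷ bitsAux f (suc m / 2)
bitsAux-suc f m with suc m % 2
... | zero  = refl
... | suc _ = refl

bitsAux-fuel : ∀ f g n → n ≤ f → n ≤ g → bitsAux f n ≡ bitsAux g n
bitsAux-fuel zero    zero    zero    _         _         = refl
bitsAux-fuel zero    (suc g) zero    _         _         = refl
bitsAux-fuel (suc f) zero    zero    _         _         = refl
bitsAux-fuel (suc f) (suc g) zero    _         _         = refl
bitsAux-fuel (suc f) (suc g) (suc m) (s≤s m≤f) (s≤s m≤g) = begin
  bitsAux (suc f) (suc m)                       ≡⟨ bitsAux-suc f m ⟩
  toBit (suc m % 2) ∷ bitsAux f (suc m / 2)
    ≡⟨ cong (toBit (suc m % 2) ∷_) (bitsAux-fuel f g (suc m / 2) (half≤ m≤f) (half≤ m≤g)) ⟩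
  toBit (suc m % 2) ∷ bitsAux g (suc m / 2)     ≡⟨ bitsAux-suc g m ⟨
  bitsAux (suc g) (suc m)                       ∎
  where
  open ≡-Reasoning
  half≤ : ∀ {h} → m ≤ h → suc m / 2 ≤ h
  half≤ = ≤-trans (<⇒≤pred (half<self m))

bitsLSB-suc : ∀ m → bitsLSB (suc m) ≡ toBit (suc m % 2) ∷ bitsLSB (suc m / 2)
bitsLSB-suc m = trans (bitsAux-suc m m)
  (cong (toBit (suc m % 2) ∷_) (bitsAux-fuel m (suc m / 2) (suc m / 2) (<⇒≤pred (half<self m)) ≤-refl))

fromBits-bitsLSB : ∀ n → fromBits (bitsLSB n) ≡ n
fromBits-bitsLSB = <-rec _ go
  where
  go : ∀ n → (∀ {m} → m < n → fromBits (bitsLSB m) ≡ m) → fromBits (bitsLSB n) ≡ n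
  go zero    _   = refl
  go (suc m) rec = begin
    fromBits (bitsLSB (suc m))                                 ≡⟨ cong fromBits (bitsLSB-suc m) ⟩
    bitValue (toBit (suc m % 2)) + fromBits (bitsLSB (suc m / 2)) * 2
      ≡⟨ cong₂ (λ a b → a + b * 2) (bitValue-toBit (suc m % 2) (m%n<n (suc m) 2)) (rec (half<self m)) ⟩
    suc m % 2 + suc m / 2 * 2                                  ≡⟨ m≡m%n+[m/n]*n (suc m) 2 ⟨
    suc m                                                      ∎
    where open ≡-Reasoning

s₂-halve : ∀ n → s₂ n ≡ n % 2 + s₂ (n / 2)
s₂-halve zero = refl
s₂-halve (suc m) rewrite bitsLSB-suc m with suc m % 2 | m%n<n (suc m) 2
... | 0 | _ = refl
... | 1 | _ = refl
... | suc (suc _) | s≤s (s≤s ())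

s₂[b+v*2]≡b+s₂[v] : ∀ b v → s₂ (bitValue b + v * 2) ≡ bitValue b + s₂ v
s₂[b+v*2]≡b+s₂[v] b v = trans (s₂-halve (bitValue b + v * 2)) (cong₂ (λ x y → x + s₂ y) low high)
  where
  low : (bitValue b + v * 2) % 2 ≡ bitValue b
  low = trans ([m+kn]%n≡m%n (bitValue b) v 2) (bitValue%2 b)
  high : (bitValue b + v * 2) / 2 ≡ v
  high = trans (+-distrib-/-∣ʳ (bitValue b) (divides v refl)) (cong₂ _+_ (bitValue/2 b) (m*n/n≡m v 2))

s₂-fromBits : ∀ bs → s₂ (fromBits bs) ≡ ones bs
s₂-fromBits []       = refl
s₂-fromBits (b ∷ bs) = trans (s₂[b+v*2]≡b+s₂[v] b (fromBits bs)) (cong (bitValue b +_) (s₂-fromBits bs))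

fromBits-++ : ∀ xs ys → fromBits (xs ++ ys) ≡ fromBits xs + fromBits ys * 2 ^ length xs
fromBits-++ []       ys = sym (*-identityʳ (fromBits ys))
fromBits-++ (x ∷ xs) ys = begin
  bitValue x + fromBits (xs ++ ys) * 2                           ≡⟨ cong (λ v → bitValue x + v * 2) (fromBits-++ xs ys) ⟩
  bitValue x + (fromBits xs + fromBits ys * 2 ^ length xs) * 2
    ≡⟨ shift (bitValue x) (fromBits xs) (fromBits ys) (2 ^ length xs) ⟩
  bitValue x + fromBits xs * 2 + fromBits ys * (2 * 2 ^ length xs) ∎
  where
  open ≡-Reasoning
  shift : ∀ b a c p → b + (a + c * p) * 2 ≡ b + a * 2 + c * (2 * p)
  shift = solve-∀

ones-++ : ∀ xs ys → ones (xs ++ ys) ≡ ones xs + ones ys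
ones-++ []       ys = refl
ones-++ (x ∷ xs) ys = trans (cong (bitValue x +_) (ones-++ xs ys)) (sym (+-assoc (bitValue x) (ones xs) (ones ys)))

fromBits-split : ∀ k xs ys → bitsLSB k ≡ xs ++ ys → fromBits xs + fromBits ys * 2 ^ length xs ≡ k
fromBits-split k xs ys β≡ = trans (sym (fromBits-++ xs ys)) (trans (cong fromBits (sym β≡)) (fromBits-bitsLSB k))

module _ {A : Set} where

  replicate-+ : ∀ m n (x : A) → replicate (m + n) x ≡ replicate m x ++ replicate n x
  replicate-+ zero    n x = refl
  replicate-+ (suc m) n x = cong (x ∷_) (replicate-+ m n x)

  replicate-∷ʳ : ∀ n (x : A) → replicate n x ++ x ∷ [] ≡ x ∷ replicate n x
  replicate-∷ʳ zero    x = refl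
  replicate-∷ʳ (suc n) x = cong (x ∷_) (replicate-∷ʳ n x)

  reverse-replicate : ∀ n (x : A) → reverse (replicate n x) ≡ replicate n x
  reverse-replicate zero    x = refl
  reverse-replicate (suc n) x = begin
    reverse (x ∷ replicate n x)          ≡⟨ unfold-reverse x (replicate n x) ⟩
    reverse (replicate n x) ++ x ∷ []    ≡⟨ cong (_++ x ∷ []) (reverse-replicate n x) ⟩
    replicate n x ++ x ∷ []              ≡⟨ replicate-∷ʳ n x ⟩
    x ∷ replicate n x                    ∎
    where open ≡-Reasoning

  length-replicate-++ : ∀ n (x : A) ys → length (replicate n x ++ ys) ≡ n + length ys
  length-replicate-++ n x ys = trans (length-++ (replicate n x)) (cong (_+ length ys) (length-replicate n))

ones-trues-++ : ∀ n bs → ones (replicate n true ++ bs) ≡ n + ones bs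
ones-trues-++ zero    bs = refl
ones-trues-++ (suc n) bs = cong suc (ones-trues-++ n bs)

ones-trues : ∀ n → ones (replicate n true) ≡ n
ones-trues zero    = refl
ones-trues (suc n) = cong suc (ones-trues n)

ones-falses-++ : ∀ n bs → ones (replicate n false ++ bs) ≡ ones bs
ones-falses-++ zero    bs = refl
ones-falses-++ (suc n) bs = ones-falses-++ n bs

-- Stated with suc because suc (fromBits (true ∷ bs)) is definitionally suc (fromBits bs) * 2.
fromBits-trues-++ : ∀ n bs → suc (fromBits (replicate n true ++ bs)) ≡ 2 ^ n * suc (fromBits bs)
fromBits-trues-++ zero    bs = sym (+-identityʳ _)
fromBits-trues-++ (suc n) bs = begin
  suc (fromBits (replicate n true ++ bs)) * 2   ≡⟨ cong (_* 2) (fromBits-trues-++ n bs) ⟩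
  2 ^ n * suc (fromBits bs) * 2                 ≡⟨ double-left (2 ^ n) (suc (fromBits bs)) ⟩
  2 * 2 ^ n * suc (fromBits bs)                 ∎
  where
  open ≡-Reasoning
  double-left : ∀ p c → p * c * 2 ≡ 2 * p * c
  double-left = solve-∀

fromBits-trues : ∀ n → suc (fromBits (replicate n true)) ≡ 2 ^ n
fromBits-trues zero    = refl
fromBits-trues (suc n) = trans (cong (_* 2) (fromBits-trues n)) (*-comm (2 ^ n) 2)

fromBits-falses-++ : ∀ n bs → fromBits (replicate n false ++ bs) ≡ 2 ^ n * fromBits bs
fromBits-falses-++ zero    bs = sym (+-identityʳ _)
fromBits-falses-++ (suc n) bs =
  trans (cong (_* 2) (fromBits-falses-++ n bs)) (trans (*-comm (2 ^ n * fromBits bs) 2) (sym (*-assoc 2 (2 ^ n) _)))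

L-split : ∀ j k bs → L j k ≡ bs → bitsLSB k ≡ reverse bs ++ drop j (bitsLSB k)
L-split j k bs L≡ = begin
  bitsLSB k                                           ≡⟨ take++drop≡id j (bitsLSB k) ⟨
  take j (bitsLSB k) ++ drop j (bitsLSB k)
    ≡⟨ cong (_++ drop j (bitsLSB k)) (reverse-involutive (take j (bitsLSB k))) ⟨
  reverse (L j k) ++ drop j (bitsLSB k)               ≡⟨ cong (λ w → reverse w ++ drop j (bitsLSB k)) L≡ ⟩
  reverse bs ++ drop j (bitsLSB k)                    ∎
  where open ≡-Reasoning

U-split : ∀ j k bs → U j k ≡ bs → bitsLSB k ≡ reverse (drop j (reverse (bitsLSB k))) ++ reverse bs
U-split j k bs U≡ = begin
  bitsLSB k                                ≡⟨ reverse-involutive (bitsLSB k) ⟨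
  reverse (reverse (bitsLSB k))            ≡⟨ cong reverse (take++drop≡id j (reverse (bitsLSB k))) ⟨
  reverse (U j k ++ D)                     ≡⟨ cong (λ w → reverse (w ++ D)) U≡ ⟩
  reverse (bs ++ D)                        ≡⟨ reverse-++ bs D ⟩
  reverse D ++ reverse bs                  ∎
  where
  open ≡-Reasoning
  D : List Bool
  D = drop j (reverse (bitsLSB k))

L-low-block : ∀ k u → L (u + 2) k ≡ false ∷ false ∷ replicate u true →
              bitsLSB k ≡ (replicate u true ++ false ∷ false ∷ []) ++ drop (u + 2) (bitsLSB k)
L-low-block k u L≡ = trans (L-split (u + 2) k _ L≡) (cong (_++ drop (u + 2) (bitsLSB k))
  (trans (reverse-++ (false ∷ false ∷ []) (replicate u true)) (cong (_++ false ∷ false ∷ []) (reverse-replicate u true))))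

U-high-block : ∀ k r → U (r + 1) k ≡ replicate r true ++ false ∷ [] →
               bitsLSB k ≡ reverse (drop (r + 1) (reverse (bitsLSB k))) ++ false ∷ replicate r true
U-high-block k r U≡ = trans (U-split (r + 1) k _ U≡) (cong (reverse (drop (r + 1) (reverse (bitsLSB k))) ++_)
  (trans (reverse-++ (replicate r true) (false ∷ [])) (cong (false ∷_) (reverse-replicate r true))))

-- A number is odious when its binary digit sum is odd.
OdiousMultipleBelow : ℕ → Set
OdiousMultipleBelow k = Σ ℕ λ n → n < k × t (k * n) ≡ 1

s₂-*-2^+1 : ∀ k B T Lo M R → bitsLSB k ≡ B ++ T → bitsLSB k ≡ Lo ++ R →
            fromBits Lo + fromBits T ≡ fromBits M → length M ≡ length Lo →
            s₂ (k * (2 ^ length B + 1)) + ones T ≡ ones Lo + ones M + ones R * 2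
s₂-*-2^+1 k B T Lo M R β≡BT β≡LoR carry |M|≡|Lo| = begin
  s₂ (k * (P + 1)) + ones T                  ≡⟨ cong (λ n → s₂ n + ones T) digits ⟩
  s₂ (fromBits (B ++ M ++ R)) + ones T       ≡⟨ cong (_+ ones T) (s₂-fromBits (B ++ M ++ R)) ⟩
  ones (B ++ M ++ R) + ones T
    ≡⟨ cong (_+ ones T) (trans (ones-++ B (M ++ R)) (cong (ones B +_) (ones-++ M R))) ⟩
  ones B + (ones M + ones R) + ones T        ≡⟨ regroup (ones B) (ones M) (ones R) (ones T) ⟩
  (ones B + ones T) + ones M + ones R        ≡⟨ cong (λ x → x + ones M + ones R) same-ones ⟩
  (ones Lo + ones R) + ones M + ones R       ≡⟨ regroup′ (ones Lo) (ones M) (ones R) ⟩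
  ones Lo + ones M + ones R * 2              ∎
  where
  open ≡-Reasoning
  P : ℕ
  P = 2 ^ length B
  regroup : ∀ b m r t → b + (m + r) + t ≡ b + t + m + r
  regroup = solve-∀
  regroup′ : ∀ l m r → l + r + m + r ≡ l + m + r * 2
  regroup′ = solve-∀
  same-ones : ones B + ones T ≡ ones Lo + ones R
  same-ones = trans (sym (ones-++ B T)) (trans (cong ones (trans (sym β≡BT) β≡LoR)) (ones-++ Lo R))
  digits : k * (P + 1) ≡ fromBits (B ++ M ++ R)
  digits = sym (begin
    fromBits (B ++ M ++ R)                                        ≡⟨ fromBits-++ B (M ++ R) ⟩
    fromBits B + fromBits (M ++ R) * P                            ≡⟨ cong (λ x → fromBits B + x * P) (fromBits-++ M R) ⟩
    fromBits B + (fromBits M + fromBits R * 2 ^ length M) * P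
      ≡⟨ cong₂ (λ x l → fromBits B + (x + fromBits R * 2 ^ l) * P) (sym carry) |M|≡|Lo| ⟩
    fromBits B + (fromBits Lo + fromBits T + fromBits R * 2 ^ length Lo) * P
      ≡⟨ collect (fromBits B) (fromBits T) (fromBits Lo) (fromBits R * 2 ^ length Lo) P ⟩
    (fromBits B + fromBits T * P) + (fromBits Lo + fromBits R * 2 ^ length Lo) * P
      ≡⟨ cong₂ (λ x y → x + y * P) (fromBits-split k B T β≡BT) (fromBits-split k Lo R β≡LoR) ⟩
    k + k * P                                                     ≡⟨ factor k P ⟩
    k * (P + 1)                                                   ∎)
    where
    collect : ∀ b t x y p → b + (x + t + y) * p ≡ (b + t * p) + (x + y) * p
    collect = solve-∀
    factor : ∀ a p → a + a * p ≡ a * (p + 1)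
    factor = solve-∀

p+1<a+b*p : ∀ a b p → 2 ≤ b → 2 ≤ p → p + 1 < a + b * p
p+1<a+b*p a b p 2≤b 2≤p = begin-strict
  p + 1       <⟨ +-monoʳ-< p 2≤p ⟩
  p + p       ≡⟨ cong (p +_) (+-identityʳ p) ⟨
  2 * p       ≤⟨ *-monoˡ-≤ p 2≤b ⟩
  b * p       ≤⟨ m≤n+m (b * p) a ⟩
  a + b * p   ∎
  where open ≤-Reasoning

carry⇒odious-multiple : ∀ k B T Lo M R → bitsLSB k ≡ B ++ T → bitsLSB k ≡ Lo ++ R →
                        fromBits Lo + fromBits T ≡ fromBits M → length M ≡ length Lo →
                        ∀ q → ones Lo + ones M ≡ ones T + (1 + q * 2) →
                        1 ≤ length B → 2 ≤ fromBits T →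
                        OdiousMultipleBelow k
carry⇒odious-multiple k B T Lo M R β≡BT β≡LoR carry |M|≡|Lo| q odd 1≤|B| 2≤T =
  2 ^ length B + 1 , below-k , odd-t
  where
  S : ℕ
  S = s₂ (k * (2 ^ length B + 1))
  S-odd : S ≡ 1 + (q + ones R) * 2
  S-odd = +-cancelʳ-≡ (ones T) S (1 + (q + ones R) * 2) (begin
    S + ones T                            ≡⟨ s₂-*-2^+1 k B T Lo M R β≡BT β≡LoR carry |M|≡|Lo| ⟩
    ones Lo + ones M + ones R * 2         ≡⟨ cong (_+ ones R * 2) odd ⟩
    ones T + (1 + q * 2) + ones R * 2     ≡⟨ regroup (ones T) q (ones R) ⟩
    1 + (q + ones R) * 2 + ones T         ∎)
    where
    open ≡-Reasoning
    regroup : ∀ x y z → x + (1 + y * 2) + z * 2 ≡ 1 + (y + z) * 2 + x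
    regroup = solve-∀
  odd-t : t (k * (2 ^ length B + 1)) ≡ 1
  odd-t = trans (cong (_% 2) S-odd) ([m+kn]%n≡m%n 1 (q + ones R) 2)
  below-k : 2 ^ length B + 1 < k
  below-k = subst (2 ^ length B + 1 <_) (fromBits-split k B T β≡BT)
    (p+1<a+b*p (fromBits B) (fromBits T) (2 ^ length B) 2≤T (^-monoʳ-≤ 2 1≤|B|))

many-leading-ones⇒odious-multiple : ∀ k w e D R →
  bitsLSB k ≡ (replicate (2 + w * 2) true ++ false ∷ false ∷ []) ++ R →
  bitsLSB k ≡ D ++ false ∷ replicate (e + (3 + w * 2)) true →
  OdiousMultipleBelow k
many-leading-ones⇒odious-multiple k w e D R β≡LoR β≡D01ʳ =
  carry⇒odious-multiple k B T Lo M R β≡BT β≡LoR carry |M|≡|Lo| w odd 1≤|B| (s≤s (s≤s z≤n))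
  where
  v M′ : ℕ
  v = suc (w * 2)
  Lo B T M : List Bool
  Lo = replicate (suc v) true ++ false ∷ false ∷ []
  B = D ++ false ∷ replicate e true
  T = replicate (suc (suc v)) true
  M = false ∷ (replicate v true ++ false ∷ true ∷ [])
  M′ = fromBits (replicate v true ++ false ∷ true ∷ [])
  open ≡-Reasoning
  β≡BT : bitsLSB k ≡ B ++ T
  β≡BT = trans β≡D01ʳ (trans (cong (λ xs → D ++ false ∷ xs) (replicate-+ e (suc (suc v)) true))
                              (sym (++-assoc D (false ∷ replicate e true) T)))
  carry : fromBits Lo + fromBits T ≡ fromBits M
  carry = +-cancelˡ-≡ 2 _ _ (begin
    2 + (fromBits Lo + fromBits T)            ≡⟨ two-sucs (fromBits Lo) (fromBits T) ⟩
    suc (fromBits Lo) + suc (fromBits T)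
      ≡⟨ cong₂ _+_ (fromBits-trues-++ (suc v) _) (fromBits-trues (suc (suc v))) ⟩
    2 * 2 ^ v * 1 + 2 * (2 * 2 ^ v)           ≡⟨ six (2 ^ v) ⟩
    2 ^ v * 3 * 2                             ≡⟨ cong (_* 2) (fromBits-trues-++ v _) ⟨
    suc M′ * 2                                ∎)
    where
    two-sucs : ∀ a b → 2 + (a + b) ≡ (1 + a) + (1 + b)
    two-sucs = solve-∀
    six : ∀ x → 2 * x * 1 + 2 * (2 * x) ≡ x * 3 * 2
    six = solve-∀
  |M|≡|Lo| : length M ≡ length Lo
  |M|≡|Lo| = trans (cong suc (length-replicate-++ v true _)) (sym (length-replicate-++ (suc v) true _))
  odd : ones Lo + ones M ≡ ones T + (1 + w * 2)
  odd = begin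
    ones Lo + ones M                          ≡⟨ cong₂ _+_ (ones-trues-++ (suc v) _) (ones-trues-++ v _) ⟩
    (2 + w * 2 + 0) + (1 + w * 2 + 1)         ≡⟨ count w ⟩
    (3 + w * 2) + (1 + w * 2)                 ≡⟨ cong (_+ (1 + w * 2)) (ones-trues (suc (suc v))) ⟨
    ones T + (1 + w * 2)                      ∎
    where
    count : ∀ w → (2 + w * 2 + 0) + (1 + w * 2 + 1) ≡ (3 + w * 2) + (1 + w * 2)
    count = solve-∀
  1≤|B| : 1 ≤ length B
  1≤|B| = ≤-trans (s≤s z≤n) (length-++-≤ʳ (false ∷ replicate e true) {D})

nonempty-prefix : ∀ xs {ys zs} → xs ++ false ∷ ys ≡ true ∷ zs → 1 ≤ length xs
nonempty-prefix []      ()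
nonempty-prefix (_ ∷ _) _ = s≤s z≤n

few-leading-ones⇒odious-multiple : ∀ k w p d D R → suc (suc p) + d ≡ 2 + w * 2 →
  bitsLSB k ≡ (replicate (2 + w * 2) true ++ false ∷ false ∷ []) ++ R →
  bitsLSB k ≡ D ++ false ∷ replicate (suc p) true →
  OdiousMultipleBelow k
few-leading-ones⇒odious-multiple k w p d D R u≡ β≡LoR β≡D01ᵖ =
  carry⇒odious-multiple k D T Lo M R β≡D01ᵖ β≡LoR carry |M|≡|Lo| (suc w) odd 1≤|D| (s≤s (s≤s z≤n))
  where
  u M′ : ℕ
  u = 2 + w * 2
  Lo T M : List Bool
  Lo = replicate u true ++ false ∷ false ∷ []
  T = false ∷ replicate (suc p) true
  M = true ∷ false ∷ (replicate p true ++ replicate d false ++ true ∷ false ∷ [])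
  M′ = fromBits (replicate p true ++ replicate d false ++ true ∷ false ∷ [])
  open ≡-Reasoning
  2^u : 2 ^ u ≡ 2 * (2 * 2 ^ p) * 2 ^ d
  2^u = trans (cong (2 ^_) (sym u≡)) (^-distribˡ-+-* 2 (suc (suc p)) d)
  M′+1 : suc M′ ≡ 2 ^ p * suc (2 ^ d * 1)
  M′+1 = trans (fromBits-trues-++ p _) (cong (λ x → 2 ^ p * suc x) (fromBits-falses-++ d _))
  carry : fromBits Lo + fromBits T ≡ fromBits M
  carry = +-cancelˡ-≡ 3 _ _ (begin
    3 + (fromBits Lo + fromBits (replicate (suc p) true) * 2)
      ≡⟨ three-sucs (fromBits Lo) (fromBits (replicate (suc p) true)) ⟩
    suc (fromBits Lo) + suc (fromBits (replicate (suc p) true)) * 2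
      ≡⟨ cong₂ (λ x y → x + y * 2) (trans (fromBits-trues-++ u _) (cong (_* 1) 2^u)) (fromBits-trues (suc p)) ⟩
    2 * (2 * 2 ^ p) * 2 ^ d * 1 + 2 * 2 ^ p * 2   ≡⟨ gather (2 ^ p) (2 ^ d) ⟩
    2 ^ p * suc (2 ^ d * 1) * 4                   ≡⟨ cong (_* 4) M′+1 ⟨
    suc M′ * 4                                    ≡⟨ spread M′ ⟩
    3 + (1 + M′ * 2 * 2)                          ∎)
    where
    three-sucs : ∀ a b → 3 + (a + b * 2) ≡ (1 + a) + (1 + b) * 2
    three-sucs = solve-∀
    gather : ∀ x y → 2 * (2 * x) * y * 1 + 2 * x * 2 ≡ x * (1 + y * 1) * 4
    gather = solve-∀
    spread : ∀ m → (1 + m) * 4 ≡ 3 + (1 + m * 2 * 2)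
    spread = solve-∀
  |M|≡|Lo| : length M ≡ length Lo
  |M|≡|Lo| = begin
    2 + length (replicate p true ++ replicate d false ++ true ∷ false ∷ [])
      ≡⟨ cong (2 +_) (trans (length-replicate-++ p true _) (cong (p +_) (length-replicate-++ d false _))) ⟩
    2 + (p + (d + 2))                        ≡⟨ reassoc p d ⟩
    suc (suc p) + d + 2                      ≡⟨ cong (_+ 2) u≡ ⟩
    u + 2                                    ≡⟨ length-replicate-++ u true _ ⟨
    length Lo                                ∎
    where
    reassoc : ∀ p d → 2 + (p + (d + 2)) ≡ 2 + p + d + 2
    reassoc = solve-∀
  odd : ones Lo + ones M ≡ ones T + (1 + suc w * 2)
  odd = begin
    ones Lo + ones M
      ≡⟨ cong₂ (λ x y → x + suc y) (ones-trues-++ u _) (trans (ones-trues-++ p _) (cong (p +_) (ones-falses-++ d _))) ⟩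
    (u + 0) + suc (p + 1)                    ≡⟨ count w p ⟩
    suc p + (1 + suc w * 2)                  ≡⟨ cong (_+ (1 + suc w * 2)) (ones-trues (suc p)) ⟨
    ones T + (1 + suc w * 2)                 ∎
    where
    count : ∀ w p → (2 + w * 2 + 0) + (1 + (p + 1)) ≡ (1 + p) + (1 + (1 + w) * 2)
    count = solve-∀
  1≤|D| : 1 ≤ length D
  1≤|D| = nonempty-prefix D (trans (sym β≡D01ᵖ) β≡LoR)

t<2 : ∀ n → t n < 2
t<2 n = m%n<n (s₂ n) 2

t≢1⇒t≡0 : ∀ n → t n ≢ 1 → t n ≡ 0
t≢1⇒t≡0 n t≢1 with t n | t<2 n
... | 0           | _ = refl
... | 1           | _ = ⊥-elim (t≢1 refl)
... | suc (suc _) | s≤s (s≤s ())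

zeros-or-IsF : ∀ k n → (∀ m → m < n → t (k * m) ≡ 0) ⊎ Σ ℕ (λ m → IsF k m × m < n)
zeros-or-IsF k zero = inj₁ (λ _ ())
zeros-or-IsF k (suc n) with zeros-or-IsF k n
... | inj₂ (m , isF , m<n) = inj₂ (m , isF , m<n⇒m<1+n m<n)
... | inj₁ zeros with t (k * n) ≟ 1
...   | yes one = inj₂ (n , (one , zeros) , n<1+n n)
...   | no ¬one = inj₁ λ m m<1+n → [ zeros m , (λ m≡n → subst (λ i → t (k * i) ≡ 0) (sym m≡n) zero-at-n) ]′
                                     (m<1+n⇒m<n∨m≡n m<1+n)
  where
  zero-at-n : t (k * n) ≡ 0
  zero-at-n = t≢1⇒t≡0 (k * n) ¬one

odious-multiple⇒f<k : ∀ k → OdiousMultipleBelow k → Σ ℕ λ m → IsF k m × m < k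
odious-multiple⇒f<k k (n , n<k , one) with zeros-or-IsF k (suc n)
... | inj₁ zeros             = ⊥-elim (1+n≢0 (trans (sym one) (zeros n (n<1+n n))))
... | inj₂ (m , isF , m<1+n) = m , isF , ≤-<-trans (m<1+n⇒m≤n m<1+n) n<k

even≥2 : ∀ u → u % 2 ≡ 0 → 2 ≤ u → Σ ℕ λ w → u ≡ 2 + w * 2
even≥2 u u%2≡0 2≤u with u / 2 | m≡m%n+[m/n]*n u 2
... | suc w | u≡ = w , trans u≡ (cong (_+ suc w * 2) u%2≡0)
... | zero  | u≡ with subst (2 ≤_) (trans u≡ (cong (_+ 0) u%2≡0)) 2≤u
...   | ()

lemma3 : (k : ℕ) → 1 ≤ k →
    (u r : ℕ) → u % 2 ≡ 0 → 2 ≤ u → 1 ≤ r → r ≢ u →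
    u + 2 ≤ len k → L (u + 2) k ≡ false ∷ false ∷ replicate u true →
    r + 1 ≤ len k → U (r + 1) k ≡ replicate r true ++ (false ∷ []) →
    Σ ℕ (λ m → IsF k m × m < k)
lemma3 k _ u zero    _      _   ()  _   _ _  _ _
lemma3 k _ u (suc p) u-even 2≤u _ r≢u _ L≡ _ U≡ with even≥2 u u-even 2≤u
... | w , refl = odious-multiple⇒f<k k (by-comparison (<-cmp (suc p) u))
  where
  D R : List Bool
  D = reverse (drop (suc p + 1) (reverse (bitsLSB k)))
  R = drop (u + 2) (bitsLSB k)
  β≡LoR : bitsLSB k ≡ (replicate u true ++ false ∷ false ∷ []) ++ R
  β≡LoR = L-low-block k u L≡
  β≡D01ʳ : bitsLSB k ≡ D ++ false ∷ replicate (suc p) true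
  β≡D01ʳ = U-high-block k (suc p) U≡
  by-comparison : Tri (suc p < u) (suc p ≡ u) (u < suc p) → OdiousMultipleBelow k
  by-comparison (tri< r<u _ _) =
    few-leading-ones⇒odious-multiple k w p (u ∸ suc (suc p)) D R (m+[n∸m]≡n r<u) β≡LoR β≡D01ʳ
  by-comparison (tri≈ _ r≡u _) = ⊥-elim (r≢u r≡u)
  by-comparison (tri> _ _ u<r) =
    many-leading-ones⇒odious-multiple k w (suc p ∸ suc u) D R β≡LoR
      (subst (λ n → bitsLSB k ≡ D ++ false ∷ replicate n true) (sym (m∸n+n≡m u<r)) β≡D01ʳ)
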